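{- Let $\mathcal{A}_\tau=\mathcal{A}\cup\{\tau\}$ be a countable set and let $T$ be an effective $\mathcal{A}_\tau$-labelled transition system. Then there exists an infinitary reactive Turing machine $\mathcal{M}$ with an effective transition relation such that $T$ and $\mathcal{T}(\mathcal{M})$ are divergence-preserving branching bisimilar.
   Context: An $\mathcal{A}_\tau$-labelled transition system is a triple $(\mathcal{S},\to,\uparrow)$ with $\to\subseteq\mathcal{S}\times\mathcal{A}_\tau\times\mathcal{S}$ and $\uparrow\in\mathcal{S}$; $\tau\notin\mathcal{A}$ is the internal action. It is effective if $\to$ is a recursively enumerable set with respect to some suitable encoding (Gödel numbering) of states and actions. Branching bisimilarity: write $s\xrightarrow{(a)}t$ for "$s\xrightarrow{a}t$, or $a=\tau$ and $s=t$"; $\to^*$, $\to^+$ are the reflexive-transitive and transitive closures of $\xrightarrow{\tau}$. A branching bisimulation between $T_1=(\mathcal{S}_1,\to_1,\uparrow_1)$ and $T_2=(\mathcal{S}_2,\to_2,\uparrow_2)$ is $R\subseteq\mathcal{S}_1\times\mathcal{S}_2$ such that whenever $s_1Rs_2$: (1) if $s_1\xrightarrow{a}_1s_1'$ then there are $s_2'',s_2'$ with $s_2\to_2^*s_2''\xrightarrow{(a)}_2s_2'$, $s_1Rs_2''$, $s_1'Rs_2'$; (2) symmetrically for transitions of $s_2$. It is divergence-preserving if moreover whenever $s_1Rs_2$: (3) if there is an infinite sequence $s_1=s_{1,0}\xrightarrow{\tau}s_{1,1}\xrightarrow{\tau}\cdots$ with $s_{1,i}Rs_2$ for all $i$, then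 there is $s_2'$ with $s_2\to^+s_2'$ and $s_{1,i}Rs_2'$ for some $i$; (4) symmetrically. $T_1,T_2$ are divergence-preserving branching bisimilar if such an $R$ relates the initial states. An infinitary reactive Turing machine (RTM$^\infty$) over countable action set $\mathcal{A}_\tau$ and countable data set $\mathcal{D}$ ($\mathcal{D}_\Box=\mathcal{D}\cup\{\Box\}$, $\Box$ the blank) is $(\mathcal{S},\to,\uparrow)$ with $\mathcal{S}$ a countable set of states, $\to\subseteq\mathcal{S}\times\mathcal{D}_\Box\times\mathcal{A}_\tau\times\mathcal{D}_\Box\times\{L,R\}\times\mathcal{S}$ countable (write $s\xrightarrow{a[d/e]M}t$), $\uparrow\in\mathcal{S}$. Its transition relation is effective if for every $(s,d)\in\mathcal{S}\times\mathcal{D}_\Box$ the set $\{(a,e,M,t)\mid s\xrightarrow{a[d/e]M}t\}$ is recursively enumerable with respect to some encoding. The associated transition system $\mathcal{T}(\mathcal{M})$ has as states the configurations $(s,\delta)$, $\delta$ a finite sequence over $\mathcal{D}_\Box$ and marked copies $\check d$ with exactly one marked symbol (head position); with $\overleftarrow{\delta}$ ($\overrightarrow{\delta}$) denoting $\delta\in\mathcal{D}_\Box^*$ with its right-most (left-most) symbol marked, or $\check\Box$ if $\delta$ is empty, its transitions are $(s,\delta_L\check d\delta_R)\xrightarrow{a}(t,\overleftarrow{\delta_L}e\delta_R)$ iff $s\xrightarrow{a[d/e]L}t$ and $(s,\delta_L\check d\delta_R)\xrightarrow{a}(t,\delta_Le\overrightarrow{\delta_R})$ iff $s\xrightarrow{a[d/e]R}t$;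 its initial state is $(\uparrow,\check\Box)$. -}

module Defs where

open import Data.Nat using (ℕ; zero; suc; _<_)
open import Data.Fin using (Fin)
open import Data.Vec using (Vec; []; _∷_; lookup)
open import Data.List using (List; []; _∷_)
open import Data.Maybe using (Maybe; just; nothing)
open import Data.Product using (Σ; ∃; _×_; _,_)
open import Data.Sum using (_⊎_)
open import Function.Definitions using (Injective)
open import Function.Bundles using (_⇔_)
open import Relation.Binary.PropositionalEquality using (_≡_)

Countable : Set → Set
Countable X = Σ (X → ℕ) λ f → Injective _≡_ _≡_ f

-- Partial recursive functions (Kleene), as a model of computability

data PR : ℕ → Set where
  zer  : ∀ {n} → PR n
  succ : PR 1
  proj : ∀ {n} → Fin n → PR n
  comp : ∀ {m n} → PR m → Vec (PR n) m → PR n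
  prec : ∀ {n} → PR n → PR (suc (suc n)) → PR (suc n)
  mu   : ∀ {n} → PR (suc n) → PR n

mutual
  data _⟦_⟧≡_ : ∀ {n} → PR n → Vec ℕ n → ℕ → Set where
    ezer  : ∀ {n} {xs : Vec ℕ n} → zer ⟦ xs ⟧≡ 0
    esucc : ∀ {x} → succ ⟦ x ∷ [] ⟧≡ suc x
    eproj : ∀ {n} {i : Fin n} {xs} → proj i ⟦ xs ⟧≡ lookup xs i
    ecomp : ∀ {m n} {f : PR m} {gs : Vec (PR n) m} {xs ys z} →
            gs ⟦ xs ⟧*≡ ys → f ⟦ ys ⟧≡ z → comp f gs ⟦ xs ⟧≡ z
    eprec0 : ∀ {n} {g : PR n} {f} {xs z} →
             g ⟦ xs ⟧≡ z → prec g f ⟦ 0 ∷ xs ⟧≡ z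
    eprecS : ∀ {n} {g : PR n} {f} {xs y w z} →
             prec g f ⟦ y ∷ xs ⟧≡ w → f ⟦ y ∷ w ∷ xs ⟧≡ z →
             prec g f ⟦ suc y ∷ xs ⟧≡ z
    emu   : ∀ {n} {f : PR (suc n)} {xs y} →
            f ⟦ y ∷ xs ⟧≡ 0 →
            (∀ z → z < y → ∃ λ k → f ⟦ z ∷ xs ⟧≡ suc k) →
            mu f ⟦ xs ⟧≡ y

  data _⟦_⟧*≡_ : ∀ {m n} → Vec (PR n) m → Vec ℕ n → Vec ℕ m → Set where
    [] : ∀ {n} {xs : Vec ℕ n} → [] ⟦ xs ⟧*≡ []
    _∷_ : ∀ {m n} {g : PR n} {gs : Vec (PR n) m} {xs y ys} →
          g ⟦ xs ⟧≡ y → gs ⟦ xs ⟧*≡ ys → (g ∷ gs) ⟦ xs ⟧*≡ (y ∷ ys)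

RE : (n : ℕ) → (Vec ℕ n → Set) → Set
RE n P = Σ (PR n) λ e → ∀ xs → P xs ⇔ (∃ λ y → e ⟦ xs ⟧≡ y)

Act : Set → Set
Act A = Maybe A

τ : ∀ {A} → Act A
τ = nothing

record LTS (A : Set) : Set₁ where
  field
    State : Set
    _─[_]→_ : State → Act A → State → Set
    init : State
open LTS public

Effective : ∀ {A} → LTS A → Set
Effective {A} T =
  Σ (Countable (State T)) λ { (encS , _) →
  Σ (Countable (Act A)) λ { (encA , _) →
  RE 3 (λ { (x ∷ y ∷ z ∷ []) →
    ∃ λ s → ∃ λ a → ∃ λ t →
      encS s ≡ x × encA a ≡ y × encS t ≡ z × LTS._─[_]→_ T s a t }) } }

module _ {A : Set} (T : LTS A) where
  private
    S = State T
    _⟶_⟶_ = LTS._─[_]→_ T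

  _─⟨_⟩→_ : S → Act A → S → Set
  s ─⟨ a ⟩→ t = (s ⟶ a ⟶ t) ⊎ (a ≡ τ × s ≡ t)

  data _→*_ : S → S → Set where
    ε   : ∀ {s} → s →* s
    _◅_ : ∀ {s t u} → s ⟶ τ ⟶ t → t →* u → s →* u

  data _→⁺_ : S → S → Set where
    [_] : ∀ {s t} → s ⟶ τ ⟶ t → s →⁺ t
    _◅_ : ∀ {s t u} → s ⟶ τ ⟶ t → t →⁺ u → s →⁺ u

module _ {A : Set} (T₁ T₂ : LTS A) where
  private
    S₁ = State T₁
    S₂ = State T₂

  -- clauses (1) and (3) for R; clauses (2) and (4) are obtained by flipping
  TransferClause : (S₁ → S₂ → Set) → Set
  TransferClause R = ∀ {s₁ s₂ a s₁'} → R s₁ s₂ → LTS._─[_]→_ T₁ s₁ a s₁' →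
    ∃ λ s₂'' → ∃ λ s₂' → _→*_ T₂ s₂ s₂'' × _─⟨_⟩→_ T₂ s₂'' a s₂' ×
                          R s₁ s₂'' × R s₁' s₂'

  DivergenceClause : (S₁ → S₂ → Set) → Set
  DivergenceClause R = ∀ {s₁ s₂} → R s₁ s₂ →
    (f : ℕ → S₁) → f 0 ≡ s₁ →
    (∀ i → LTS._─[_]→_ T₁ (f i) τ (f (suc i))) →
    (∀ i → R (f i) s₂) →
    ∃ λ s₂' → _→⁺_ T₂ s₂ s₂' × ∃ λ i → R (f i) s₂'

flip : ∀ {X Y : Set} → (X → Y → Set) → Y → X → Set
flip R y x = R x y

record IsDPBranchingBisim {A : Set} (T₁ T₂ : LTS A)
       (R : State T₁ → State T₂ → Set) : Set where
  field
    clause1 : TransferClause T₁ T₂ R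
    clause2 : TransferClause T₂ T₁ (flip R)
    clause3 : DivergenceClause T₁ T₂ R
    clause4 : DivergenceClause T₂ T₁ (flip R)

_⇆Δb_ : ∀ {A} → LTS A → LTS A → Set₁
T₁ ⇆Δb T₂ = Σ (State T₁ → State T₂ → Set) λ R →
  IsDPBranchingBisim T₁ T₂ R × R (init T₁) (init T₂)

data Dir : Set where
  L R : Dir

encDir : Dir → ℕ
encDir L = 0
encDir R = 1

Dat : Set → Set
Dat D = Maybe D

□ : ∀ {D} → Dat D
□ = nothing

record RTM∞ (A D : Set) : Set₁ where
  field
    St : Set
    _─[_/_/_/_]→_ : St → Dat D → Act A → Dat D → Dir → St → Set
    start : St
    St-countable : Countable St
    D-countable  : Countable D
    A-countable  : Countable (Act A)
    trans-countable : Countable (Σ St λ s → Σ (Dat D) λ d → Σ (Act A) λ a →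
                        Σ (Dat D) λ e → Σ Dir λ M → Σ St λ t →
                        _─[_/_/_/_]→_ s d a e M t)
open RTM∞ public

EffectiveRTM : ∀ {A D} → RTM∞ A D → Set
EffectiveRTM {A} {D} M =
  Σ (Countable (St M)) λ { (encS , _) →
  Σ (Countable (Dat D)) λ { (encD , _) →
  Σ (Countable (Act A)) λ { (encA , _) →
  ∀ s d → RE 4 (λ { (x ∷ y ∷ z ∷ w ∷ []) →
    ∃ λ a → ∃ λ e → ∃ λ m → ∃ λ t →
      encA a ≡ x × encD e ≡ y × encDir m ≡ z × encS t ≡ w ×
      RTM∞._─[_/_/_/_]→_ M s d a e m t }) } } }

-- Tape contents δ_L ď δ_R, represented as (reverse δ_L , d , δ_R):
-- the left part is stored nearest-symbol-first.
record Tape (D : Set) : Set where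
  constructor tape
  field
    left  : List (Dat D)
    head  : Dat D
    right : List (Dat D)

moveL : ∀ {D} → List (Dat D) → Dat D → List (Dat D) → Tape D
moveL []      e r = tape [] □ (e ∷ r)
moveL (x ∷ l) e r = tape l x (e ∷ r)

moveR : ∀ {D} → List (Dat D) → Dat D → List (Dat D) → Tape D
moveR l e []      = tape (e ∷ l) □ []
moveR l e (x ∷ r) = tape (e ∷ l) x r

Config : ∀ {A D} → RTM∞ A D → Set
Config {D = D} M = St M × Tape D

data ConfStep {A D} (M : RTM∞ A D) : Config M → Act A → Config M → Set where
  stepL : ∀ {s t a d e l r} → RTM∞._─[_/_/_/_]→_ M s d a e L t →
          ConfStep M (s , tape l d r) a (t , moveL l e r)
  stepR : ∀ {s t a d e l r} → RTM∞._─[_/_/_/_]→_ M s d a e R t →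
          ConfStep M (s , tape l d r) a (t , moveR l e r)

𝒯 : ∀ {A D} → RTM∞ A D → LTS A
𝒯 M = record
  { State = Config M
  ; _─[_]→_ = ConfStep M
  ; init = start M , tape [] □ [] }

-- The machine has the states of T and, in state s, may perform an a-step to t
-- exactly when T can; it ignores its tape, so 𝒯(M) is T with a tape attached
-- that never matters, and "same control state" is a divergence-preserving
-- (indeed strong) bisimulation. Effectiveness of T makes the transition
-- relation of M effective: for fixed s the admissible (a , e , M , t) are
-- those whose codes make the enumerating program of T halt on (s , a , t).
-- The only subtle requirement is that the type of transitions of M be
-- countable; this is met by taking as transition proofs the halting
-- computations of that program, which are unique.
module Submission where

open import Defs
open import Data.Nat using (ℕ; zero; suc; _<_; _≤_)
open import Data.Nat.Properties using (m<1+n⇒m<n∨m≡n; <-cmp; ≤-refl; ≤-trans; n≤1+n; suc-injective)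
open import Data.Fin using (Fin; zero; suc)
open import Data.Vec using (Vec; []; _∷_; lookup)
open import Data.Maybe using (Maybe; just; nothing)
open import Data.Product using (Σ; ∃; _×_; _,_; proj₁; proj₂)
open import Data.Sum using (inj₁; inj₂)
open import Data.Empty using (⊥; ⊥-elim)
open import Function.Bundles using (_⇔_; mk⇔; Equivalence)
open import Function.Construct.Composition using (_⇔-∘_)
open import Function.Construct.Symmetry using (⇔-sym)
open import Function.Definitions using (Injective)
open import Relation.Binary using (tri<; tri≈; tri>)
open import Relation.Binary.PropositionalEquality using (_≡_; _≢_; refl; cong; cong₂; sym; subst)
open import Relation.Nullary.Irrelevant using (Irrelevant)

-- The premise of `emu` is a function, so without function extensionality its
-- derivations are not unique; replacing it by the inductive `PositiveBelow`
-- makes them so.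

mutual
  data _⟨_⟩⇓_ : ∀ {n} → PR n → Vec ℕ n → ℕ → Set where
    zer⇓   : ∀ {n} {xs : Vec ℕ n} → zer ⟨ xs ⟩⇓ 0
    succ⇓  : ∀ {x} → succ ⟨ x ∷ [] ⟩⇓ suc x
    proj⇓  : ∀ {n} {i : Fin n} {xs} → proj i ⟨ xs ⟩⇓ lookup xs i
    comp⇓  : ∀ {m n} {f : PR m} {gs : Vec (PR n) m} {xs ys z} →
             gs ⟨ xs ⟩*⇓ ys → f ⟨ ys ⟩⇓ z → comp f gs ⟨ xs ⟩⇓ z
    prec0⇓ : ∀ {n} {g : PR n} {f} {xs z} →
             g ⟨ xs ⟩⇓ z → prec g f ⟨ 0 ∷ xs ⟩⇓ z
    precS⇓ : ∀ {n} {g : PR n} {f} {xs y w z} →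
             prec g f ⟨ y ∷ xs ⟩⇓ w → f ⟨ y ∷ w ∷ xs ⟩⇓ z →
             prec g f ⟨ suc y ∷ xs ⟩⇓ z
    mu⇓    : ∀ {n} {f : PR (suc n)} {xs y} →
             f ⟨ y ∷ xs ⟩⇓ 0 → PositiveBelow f xs y → mu f ⟨ xs ⟩⇓ y

  data _⟨_⟩*⇓_ : ∀ {m n} → Vec (PR n) m → Vec ℕ n → Vec ℕ m → Set where
    []  : ∀ {n} {xs : Vec ℕ n} → [] ⟨ xs ⟩*⇓ []
    _∷_ : ∀ {m n} {g : PR n} {gs : Vec (PR n) m} {xs y ys} →
          g ⟨ xs ⟩⇓ y → gs ⟨ xs ⟩*⇓ ys → (g ∷ gs) ⟨ xs ⟩*⇓ (y ∷ ys)

  data PositiveBelow {n} (f : PR (suc n)) (xs : Vec ℕ n) : ℕ → Set where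
    []  : PositiveBelow f xs 0
    _▸_ : ∀ {y k} → PositiveBelow f xs y → f ⟨ y ∷ xs ⟩⇓ suc k →
          PositiveBelow f xs (suc y)

mutual
  ⇓-deterministic : ∀ {n} {e : PR n} {xs y y'} →
                    e ⟨ xs ⟩⇓ y → e ⟨ xs ⟩⇓ y' → y ≡ y'
  ⇓-deterministic zer⇓ zer⇓ = refl
  ⇓-deterministic succ⇓ succ⇓ = refl
  ⇓-deterministic proj⇓ proj⇓ = refl
  ⇓-deterministic (comp⇓ p q) (comp⇓ p' q') with ⇓*-deterministic p p'
  ... | refl = ⇓-deterministic q q'
  ⇓-deterministic (prec0⇓ d) (prec0⇓ d') = ⇓-deterministic d d'
  ⇓-deterministic (precS⇓ p q) (precS⇓ p' q') with ⇓-deterministic p p'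
  ... | refl = ⇓-deterministic q q'
  ⇓-deterministic (mu⇓ {y = y} d b) (mu⇓ {y = y'} d' b') with <-cmp y y'
  ... | tri< y<y' _ _ = ⊥-elim (positiveBelow-≢0 b' d y<y')
  ... | tri≈ _ y≡y' _ = y≡y'
  ... | tri> _ _ y'<y = ⊥-elim (positiveBelow-≢0 b d' y'<y)

  ⇓*-deterministic : ∀ {m n} {gs : Vec (PR n) m} {xs ys ys'} →
                     gs ⟨ xs ⟩*⇓ ys → gs ⟨ xs ⟩*⇓ ys' → ys ≡ ys'
  ⇓*-deterministic [] [] = refl
  ⇓*-deterministic (p ∷ ps) (q ∷ qs) = cong₂ _∷_ (⇓-deterministic p q) (⇓*-deterministic ps qs)

  positiveBelow-≢0 : ∀ {n} {f : PR (suc n)} {xs y z} →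
                     PositiveBelow f xs y → f ⟨ z ∷ xs ⟩⇓ 0 → z < y → ⊥
  positiveBelow-≢0 (b ▸ p) d z<1+y with m<1+n⇒m<n∨m≡n z<1+y
  ... | inj₁ z<y = positiveBelow-≢0 b d z<y
  ... | inj₂ refl with ⇓-deterministic p d
  ... | ()

mutual
  ⇓-irrelevant : ∀ {n} {e : PR n} {xs y} → Irrelevant (e ⟨ xs ⟩⇓ y)
  ⇓-irrelevant zer⇓ zer⇓ = refl
  ⇓-irrelevant succ⇓ succ⇓ = refl
  ⇓-irrelevant proj⇓ proj⇓ = refl
  ⇓-irrelevant (comp⇓ p q) (comp⇓ p' q') with ⇓*-deterministic p p'
  ... | refl = cong₂ comp⇓ (⇓*-irrelevant p p') (⇓-irrelevant q q')
  ⇓-irrelevant (prec0⇓ d) (prec0⇓ d') = cong prec0⇓ (⇓-irrelevant d d')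
  ⇓-irrelevant (precS⇓ p q) (precS⇓ p' q') with ⇓-deterministic p p'
  ... | refl = cong₂ precS⇓ (⇓-irrelevant p p') (⇓-irrelevant q q')
  ⇓-irrelevant (mu⇓ d b) (mu⇓ d' b') = cong₂ mu⇓ (⇓-irrelevant d d') (positiveBelow-irrelevant b b')

  ⇓*-irrelevant : ∀ {m n} {gs : Vec (PR n) m} {xs ys} → Irrelevant (gs ⟨ xs ⟩*⇓ ys)
  ⇓*-irrelevant [] [] = refl
  ⇓*-irrelevant (p ∷ ps) (q ∷ qs) = cong₂ _∷_ (⇓-irrelevant p q) (⇓*-irrelevant ps qs)

  positiveBelow-irrelevant : ∀ {n} {f : PR (suc n)} {xs y} → Irrelevant (PositiveBelow f xs y)
  positiveBelow-irrelevant [] [] = refl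
  positiveBelow-irrelevant (b ▸ p) (b' ▸ p') with ⇓-deterministic p p'
  ... | refl = cong₂ _▸_ (positiveBelow-irrelevant b b') (⇓-irrelevant p p')

mutual
  ⟦⟧⇒⇓ : ∀ {n} {e : PR n} {xs y} → e ⟦ xs ⟧≡ y → e ⟨ xs ⟩⇓ y
  ⟦⟧⇒⇓ ezer = zer⇓
  ⟦⟧⇒⇓ esucc = succ⇓
  ⟦⟧⇒⇓ eproj = proj⇓
  ⟦⟧⇒⇓ (ecomp p q) = comp⇓ (⟦⟧*⇒⇓* p) (⟦⟧⇒⇓ q)
  ⟦⟧⇒⇓ (eprec0 d) = prec0⇓ (⟦⟧⇒⇓ d)
  ⟦⟧⇒⇓ (eprecS p q) = precS⇓ (⟦⟧⇒⇓ p) (⟦⟧⇒⇓ q)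
  ⟦⟧⇒⇓ {xs = xs} (emu {f = f} {y = y} d positive) = mu⇓ (⟦⟧⇒⇓ d) (below y ≤-refl)
    where
      below : ∀ w → w ≤ y → PositiveBelow f xs w
      below zero    _   = []
      below (suc w) w<y = below w (≤-trans (n≤1+n w) w<y) ▸ ⟦⟧⇒⇓ (proj₂ (positive w w<y))

  ⟦⟧*⇒⇓* : ∀ {m n} {gs : Vec (PR n) m} {xs ys} → gs ⟦ xs ⟧*≡ ys → gs ⟨ xs ⟩*⇓ ys
  ⟦⟧*⇒⇓* [] = []
  ⟦⟧*⇒⇓* (p ∷ ps) = ⟦⟧⇒⇓ p ∷ ⟦⟧*⇒⇓* ps

mutual
  ⇓⇒⟦⟧ : ∀ {n} {e : PR n} {xs y} → e ⟨ xs ⟩⇓ y → e ⟦ xs ⟧≡ y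
  ⇓⇒⟦⟧ zer⇓ = ezer
  ⇓⇒⟦⟧ succ⇓ = esucc
  ⇓⇒⟦⟧ proj⇓ = eproj
  ⇓⇒⟦⟧ (comp⇓ p q) = ecomp (⇓*⇒⟦⟧* p) (⇓⇒⟦⟧ q)
  ⇓⇒⟦⟧ (prec0⇓ d) = eprec0 (⇓⇒⟦⟧ d)
  ⇓⇒⟦⟧ (precS⇓ p q) = eprecS (⇓⇒⟦⟧ p) (⇓⇒⟦⟧ q)
  ⇓⇒⟦⟧ (mu⇓ d b) = emu (⇓⇒⟦⟧ d) (positiveBelow⇒positive b)

  ⇓*⇒⟦⟧* : ∀ {m n} {gs : Vec (PR n) m} {xs ys} → gs ⟨ xs ⟩*⇓ ys → gs ⟦ xs ⟧*≡ ys
  ⇓*⇒⟦⟧* [] = []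
  ⇓*⇒⟦⟧* (p ∷ ps) = ⇓⇒⟦⟧ p ∷ ⇓*⇒⟦⟧* ps

  positiveBelow⇒positive : ∀ {n} {f : PR (suc n)} {xs y} → PositiveBelow f xs y →
                           ∀ z → z < y → ∃ λ k → f ⟦ z ∷ xs ⟧≡ suc k
  positiveBelow⇒positive (b ▸ p) z z<1+y with m<1+n⇒m<n∨m≡n z<1+y
  ... | inj₁ z<y  = positiveBelow⇒positive b z z<y
  ... | inj₂ refl = _ , ⇓⇒⟦⟧ p

Halts : ∀ {n} → PR n → Vec ℕ n → Set
Halts e xs = ∃ λ y → e ⟦ xs ⟧≡ y

HaltsCanonically : ∀ {n} → PR n → Vec ℕ n → Set
HaltsCanonically e xs = ∃ λ y → e ⟨ xs ⟩⇓ y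

halts⇔haltsCanonically : ∀ {n} {e : PR n} {xs} → Halts e xs ⇔ HaltsCanonically e xs
halts⇔haltsCanonically = mk⇔ (λ (y , d) → y , ⟦⟧⇒⇓ d) (λ (y , d) → y , ⇓⇒⟦⟧ d)

haltsCanonically-irrelevant : ∀ {n} {e : PR n} {xs} → Irrelevant (HaltsCanonically e xs)
haltsCanonically-irrelevant (y , d) (y' , d') with ⇓-deterministic d d'
... | refl = cong (y ,_) (⇓-irrelevant d d')

double : ℕ → ℕ
double zero    = zero
double (suc n) = suc (suc (double n))

double-injective : ∀ {m n} → double m ≡ double n → m ≡ n
double-injective {zero}  {zero}  refl = refl
double-injective {suc m} {suc n} eq   = cong suc (double-injective (suc-injective (suc-injective eq)))

double≢1+double : ∀ {m n} → double m ≢ suc (double n)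
double≢1+double {suc m} {suc n} eq = double≢1+double {m} {n} (suc-injective (suc-injective eq))

-- Binary interleaving: the first component counts the trailing 1-bits.
pair : ℕ → ℕ → ℕ
pair zero    n = double n
pair (suc m) n = suc (double (pair m n))

pair-injective : ∀ {m n m' n'} → pair m n ≡ pair m' n' → m ≡ m' × n ≡ n'
pair-injective {zero}  {_} {zero}   eq = refl , double-injective eq
pair-injective {zero}  {_} {suc m'} eq = ⊥-elim (double≢1+double eq)
pair-injective {suc m} {_} {zero}   eq = ⊥-elim (double≢1+double (sym eq))
pair-injective {suc m} {_} {suc m'} eq with pair-injective {m} {_} {m'} (double-injective (suc-injective eq))
... | refl , n≡n' = refl , n≡n'

ℕ-countable : Countable ℕ
ℕ-countable = (λ n → n) , (λ eq → eq)

encodeMaybe : ∀ {X : Set} → (X → ℕ) → Maybe X → ℕ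
encodeMaybe f nothing  = 0
encodeMaybe f (just x) = suc (f x)

Maybe-countable : ∀ {X : Set} → Countable X → Countable (Maybe X)
Maybe-countable {X} (f , f-injective) = encodeMaybe f , injective
  where
    injective : ∀ {u v : Maybe X} → encodeMaybe f u ≡ encodeMaybe f v → u ≡ v
    injective {nothing} {nothing} refl = refl
    injective {just x}  {just y}  eq   = cong just (f-injective (suc-injective eq))

encodeMaybe-id-surjective : ∀ n → ∃ λ u → encodeMaybe (λ m → m) u ≡ n
encodeMaybe-id-surjective zero    = nothing , refl
encodeMaybe-id-surjective (suc n) = just n , refl

Dir-countable : Countable Dir
Dir-countable = encDir , injective
  where
    injective : ∀ {m m'} → encDir m ≡ encDir m' → m ≡ m'
    injective {L} {L} refl = refl
    injective {R} {R} refl = refl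

Σ-countable : ∀ {X : Set} {P : X → Set} → Countable X → (∀ x → Countable (P x)) → Countable (Σ X P)
Σ-countable {X} {P} (f , f-injective) g = encode , injective
  where
    encode : Σ X P → ℕ
    encode (x , p) = pair (f x) (proj₁ (g x) p)

    injective : ∀ {u v} → encode u ≡ encode v → u ≡ v
    injective {x , p} {x' , p'} eq with pair-injective {f x} {_} {f x'} eq
    ... | fx≡fx' , gp≡gp' with f-injective fx≡fx'
    ... | refl = cong (x ,_) (proj₂ (g x) gp≡gp')

irrelevant⇒countable : ∀ {X : Set} → Irrelevant X → Countable X
irrelevant⇒countable irrelevant = (λ _ → 0) , (λ {x} {y} _ → irrelevant x y)

const : ∀ {n} → ℕ → PR n
const zero    = zer
const (suc c) = comp succ (const c ∷ [])

const-⟦⟧ : ∀ {n} c {xs : Vec ℕ n} → const c ⟦ xs ⟧≡ c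
const-⟦⟧ zero    = ezer
const-⟦⟧ (suc c) = ecomp (const-⟦⟧ c ∷ []) esucc

const-⟦⟧⁻¹ : ∀ {n} c {xs : Vec ℕ n} {v} → const c ⟦ xs ⟧≡ v → v ≡ c
const-⟦⟧⁻¹ zero    ezer                     = refl
const-⟦⟧⁻¹ (suc c) (ecomp (p ∷ []) esucc) = cong suc (const-⟦⟧⁻¹ c p)

pred : PR 1
pred = prec zer (proj zero)

-- μ z. pred x halts, at z = 0, exactly when x ≤ 1.
isDirCode : PR 1
isDirCode = mu (comp pred (proj (suc zero) ∷ []))

isDirCode-halts⇔ : ∀ {x} → Halts isDirCode (x ∷ []) ⇔ ∃ λ m → encDir m ≡ x
isDirCode-halts⇔ = mk⇔ to from
  where
    to : ∀ {x} → Halts isDirCode (x ∷ []) → ∃ λ m → encDir m ≡ x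
    to {zero}        _ = L , refl
    to {suc zero}    _ = R , refl
    to {suc (suc _)} (_ , emu (ecomp (eproj ∷ []) (eprecS _ ())) _)

    from : ∀ {x} → (∃ λ m → encDir m ≡ x) → Halts isDirCode (x ∷ [])
    from (L , refl) = 0 , emu (ecomp (eproj ∷ []) (eprec0 ezer)) (λ _ ())
    from (R , refl) = 0 , emu (ecomp (eproj ∷ []) (eprecS (eprec0 ezer) eproj)) (λ _ ())

both : ∀ {n} → PR n → PR n → PR n
both f g = comp (proj zero) (f ∷ g ∷ [])

both-halts⇔ : ∀ {n} {f g : PR n} {xs} → Halts (both f g) xs ⇔ (Halts f xs × Halts g xs)
both-halts⇔ = mk⇔ (λ { (_ , ecomp (p ∷ q ∷ []) eproj) → (_ , p) , (_ , q) })
                  (λ { ((_ , p) , (_ , q)) → _ , ecomp (p ∷ q ∷ []) eproj })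

-- With e enumerating the transitions of an LTS, successorCodes e c enumerates
-- the codes of the RTM∞ transitions (a , e , M , t) out of the state coded c.
successorCodes : PR 3 → ℕ → PR 4
successorCodes e c =
  both (comp e (const c ∷ proj zero ∷ proj (suc (suc (suc zero))) ∷ []))
       (comp isDirCode (proj (suc (suc zero)) ∷ []))

successorCodes-halts⇔ : ∀ e c {x y z w} →
  Halts (successorCodes e c) (x ∷ y ∷ z ∷ w ∷ []) ⇔
  (Halts e (c ∷ x ∷ w ∷ []) × ∃ λ m → encDir m ≡ z)
successorCodes-halts⇔ e c = mk⇔ to from
  where
    to : ∀ {x y z w} → Halts (successorCodes e c) (x ∷ y ∷ z ∷ w ∷ []) →
         Halts e (c ∷ x ∷ w ∷ []) × ∃ λ m → encDir m ≡ z
    to halts with Equivalence.to both-halts⇔ halts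
    ... | (_ , ecomp (c≡ ∷ eproj ∷ eproj ∷ []) p) , (_ , ecomp (eproj ∷ []) q)
      with const-⟦⟧⁻¹ c c≡
    ... | refl = (_ , p) , Equivalence.to isDirCode-halts⇔ (_ , q)

    from : ∀ {x y z w} → Halts e (c ∷ x ∷ w ∷ []) × (∃ λ m → encDir m ≡ z) →
           Halts (successorCodes e c) (x ∷ y ∷ z ∷ w ∷ [])
    from ((_ , p) , dir) with Equivalence.from isDirCode-halts⇔ dir
    ... | _ , q = Equivalence.from both-halts⇔
                    ( (_ , ecomp (const-⟦⟧ c ∷ eproj ∷ eproj ∷ []) p)
                    , (_ , ecomp (eproj ∷ []) q) )

module TapeIgnoring {A D : Set} (T : LTS A) (P : State T → Act A → State T → Set)
  (S-countable : Countable (State T)) (D-countable : Countable D)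
  (Act-countable : Countable (Act A)) (P-countable : ∀ s a t → Countable (P s a t)) where

  machine : RTM∞ A D
  machine = record
    { St              = State T
    ; _─[_/_/_/_]→_   = λ s _ a _ _ t → P s a t
    ; start           = init T
    ; St-countable    = S-countable
    ; D-countable     = D-countable
    ; A-countable     = Act-countable
    ; trans-countable =
        Σ-countable S-countable λ s → Σ-countable (Maybe-countable D-countable) λ _ →
        Σ-countable Act-countable λ a → Σ-countable (Maybe-countable D-countable) λ _ →
        Σ-countable Dir-countable λ _ → Σ-countable S-countable λ t → P-countable s a t
    }

  SameState : State T → Config machine → Set
  SameState s c = s ≡ proj₁ c

  confStep⇒P : ∀ {c a c'} → ConfStep machine c a c' → P (proj₁ c) a (proj₁ c')
  confStep⇒P (stepL p) = p
  confStep⇒P (stepR p) = p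

  module _ (P⇔step : ∀ {s a t} → P s a t ⇔ LTS._─[_]→_ T s a t) where
    private
      P⇒step : ∀ {s a t} → P s a t → LTS._─[_]→_ T s a t
      P⇒step = Equivalence.to P⇔step

      step⇒P : ∀ {s a t} → LTS._─[_]→_ T s a t → P s a t
      step⇒P = Equivalence.from P⇔step

    sameState-isDPBranchingBisim : IsDPBranchingBisim T (𝒯 machine) SameState
    sameState-isDPBranchingBisim = record
      { clause1 = λ { {s₂ = q , tape l h r} refl st →
          (q , tape l h r) , (_ , moveR l h r) , ε , inj₁ (stepR (step⇒P st)) , refl , refl }
      ; clause2 = λ { refl st → _ , _ , ε , inj₁ (P⇒step (confStep⇒P st)) , refl , refl }
      ; clause3 = λ { {s₂ = q , tape l h r} _ f _ steps same →
          (f 1 , moveR l h r)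
          , [ stepR (subst (λ s → P s τ (f 1)) (same 0) (step⇒P (steps 0))) ] , 1 , refl }
      ; clause4 = λ { _ f _ steps same →
          proj₁ (f 1)
          , [ P⇒step (subst (λ s → P s τ (proj₁ (f 1))) (sym (same 0)) (confStep⇒P (steps 0))) ]
          , 1 , refl }
      }

    bisimilar : T ⇆Δb 𝒯 machine
    bisimilar = SameState , sameState-isDPBranchingBisim , refl

module Mirror {A : Set} (T : LTS A)
  (encS : State T → ℕ) (encS-injective : Injective _≡_ _≡_ encS)
  (encA : Act A → ℕ) (encA-injective : Injective _≡_ _≡_ encA)
  (e : PR 3)
  (e-enumerates : ∀ x y z →
    (∃ λ s → ∃ λ a → ∃ λ t → encS s ≡ x × encA a ≡ y × encS t ≡ z × LTS._─[_]→_ T s a t)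
    ⇔ Halts e (x ∷ y ∷ z ∷ [])) where

  Step : State T → Act A → State T → Set
  Step s a t = HaltsCanonically e (encS s ∷ encA a ∷ encS t ∷ [])

  halts⇔step : ∀ {s a t} → Halts e (encS s ∷ encA a ∷ encS t ∷ []) ⇔ LTS._─[_]→_ T s a t
  halts⇔step {s} {a} {t} = mk⇔ to from
    where
      to : Halts e (encS s ∷ encA a ∷ encS t ∷ []) → LTS._─[_]→_ T s a t
      to halts with Equivalence.from (e-enumerates _ _ _) halts
      ... | _ , _ , _ , s≡ , a≡ , t≡ , st
        with encS-injective s≡ | encA-injective a≡ | encS-injective t≡
      ... | refl | refl | refl = st

      from : LTS._─[_]→_ T s a t → Halts e (encS s ∷ encA a ∷ encS t ∷ [])
      from st = Equivalence.to (e-enumerates _ _ _) (s , a , t , refl , refl , refl , st)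

  Step⇔step : ∀ {s a t} → Step s a t ⇔ LTS._─[_]→_ T s a t
  Step⇔step = halts⇔step ⇔-∘ ⇔-sym halts⇔haltsCanonically

  open TapeIgnoring T Step (encS , encS-injective) ℕ-countable (encA , encA-injective)
    (λ _ _ _ → irrelevant⇒countable haltsCanonically-irrelevant)
    public using (machine; bisimilar)

  machine-effective : EffectiveRTM machine
  machine-effective =
    (encS , encS-injective) , Maybe-countable ℕ-countable , (encA , encA-injective) ,
    λ s _ → successorCodes e (encS s) , λ { (_ ∷ _ ∷ _ ∷ _ ∷ []) → mk⇔ (to s) (from s) }
    where
      encD = encodeMaybe (λ n → n)

      to : ∀ s {x y z w} →
           (∃ λ a → ∃ λ d → ∃ λ m → ∃ λ t →
             encA a ≡ x × encD d ≡ y × encDir m ≡ z × encS t ≡ w × Step s a t) →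
           Halts (successorCodes e (encS s)) (x ∷ y ∷ z ∷ w ∷ [])
      to s (_ , _ , m , _ , refl , refl , refl , refl , step) =
        Equivalence.from (successorCodes-halts⇔ e (encS s))
          (Equivalence.from halts⇔haltsCanonically step , m , refl)

      from : ∀ s {x y z w} → Halts (successorCodes e (encS s)) (x ∷ y ∷ z ∷ w ∷ []) →
             ∃ λ a → ∃ λ d → ∃ λ m → ∃ λ t →
               encA a ≡ x × encD d ≡ y × encDir m ≡ z × encS t ≡ w × Step s a t
      from s {y = y} halts with Equivalence.to (successorCodes-halts⇔ e (encS s)) halts
      ... | haltsₑ , m , m≡ with Equivalence.from (e-enumerates _ _ _) haltsₑ
      ... | s' , a , t , s'≡ , a≡ , t≡ , st with encS-injective s'≡
      ... | refl =
        let d , d≡ = encodeMaybe-id-surjective y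
        in a , d , m , t , a≡ , d≡ , m≡ , t≡ , Equivalence.from Step⇔step st

-- The countability of Aτ assumed separately is already part of effectiveness.
corollary1 : (A : Set) → Countable (Act A) → (T : LTS A) → Effective T →
    Σ Set λ D → Σ (RTM∞ A D) λ M → EffectiveRTM M × (T ⇆Δb 𝒯 M)
corollary1 A _ T ((encS , encS-injective) , (encA , encA-injective) , e , e-enumerates) =
  ℕ , machine , machine-effective , bisimilar Step⇔step
  where
    open Mirror T encS encS-injective encA encA-injective e
      (λ x y z → e-enumerates (x ∷ y ∷ z ∷ []))
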